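{- Let $G=(V,E)$ be the whirl graph. Let $u,v\in V$ with $u<v$ (as rationals) and let $n>1$ be an integer with $u,v\in V_{n-1}$. If $P\subseteq G_{\ge n}$ is any $u$–$v$ path, then $$V_{n-1}\cap[u,v]\subseteq V(P)\subseteq V\cap[u,v],$$ and $P$ traverses the vertices in $V_{n-1}\cap[u,v]$ in the natural order of $\mathbb{Q}$.
   Context: The whirl graph is $G=(V,E)$ with $V:=\bigcup_{n\ge 1}V_n\subseteq\mathbb{Q}$, $V_n:=\{\tfrac{0}{3^n},\tfrac{1}{3^n},\dots,\tfrac{3^n}{3^n}\}$ (vertices are rational numbers), and $E:=\bigcup_{n\ge1}E_n$, where $E_n:=\big\{\{\tfrac{3k}{3^n},\tfrac{3k+2}{3^n}\},\{\tfrac{3k+1}{3^n},\tfrac{3k+2}{3^n}\},\{\tfrac{3k+1}{3^n},\tfrac{3k+3}{3^n}\} : 0\le k\le 3^{n-1}-1\big\}$. For $n\ge1$, $G_{\ge n}:=(V,\bigcup_{k\ge n}E_k)$. Intervals $[u,v]$ are intervals of rationals. -}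

module Defs where

open import Data.Nat as ℕ using (ℕ; suc; _∸_; _^_)
open import Data.Nat.Properties using (m^n≢0)
open import Data.Integer using (+_)
open import Data.Rational using (ℚ; _/_; _≤_; _<_)
open import Data.Product using (Σ; ∃; ∃-syntax; _×_; _,_)
open import Data.Sum using (_⊎_)
open import Data.List using (List; []; _∷_; _++_; length; lookup)
open import Data.List.Relation.Unary.Linked using (Linked)
open import Data.List.Relation.Unary.Unique.Propositional using (Unique)
open import Data.List.Membership.Propositional using (_∈_)
open import Data.Fin as Fin using (Fin)
open import Relation.Binary.PropositionalEquality using (_≡_)

frac : ℕ → ℕ → ℚ
frac k n = _/_ (+ k) (3 ^ n) {{m^n≢0 3 n}}

InV : ℕ → ℚ → Set
InV n x = ∃[ k ] (k ℕ.≤ 3 ^ n × x ≡ frac k n)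

InVtx : ℚ → Set
InVtx x = ∃[ n ] (1 ℕ.≤ n × InV n x)

SameEdge : ℚ → ℚ → ℚ → ℚ → Set
SameEdge a b x y = (x ≡ a × y ≡ b) ⊎ (x ≡ b × y ≡ a)

EdgeAt : ℕ → ℚ → ℚ → Set
EdgeAt n x y =
  1 ℕ.≤ n ×
  ∃[ k ] (k ℕ.< 3 ^ (n ∸ 1) ×
    ( SameEdge (frac (3 ℕ.* k) n) (frac (3 ℕ.* k ℕ.+ 2) n) x y
    ⊎ SameEdge (frac (3 ℕ.* k ℕ.+ 1) n) (frac (3 ℕ.* k ℕ.+ 2) n) x y
    ⊎ SameEdge (frac (3 ℕ.* k ℕ.+ 1) n) (frac (3 ℕ.* k ℕ.+ 3) n) x y))

AdjGe : ℕ → ℚ → ℚ → Set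
AdjGe n x y = ∃[ m ] (n ℕ.≤ m × EdgeAt m x y)

-- P (list of its vertices in order) is a u–v path in G_{≥ n}:
-- all vertices lie in V, they are pairwise distinct, consecutive ones are
-- adjacent in G_{≥ n}, P starts at u and ends at v.
record IsPathGe (n : ℕ) (u v : ℚ) (P : List ℚ) : Set where
  field
    inVtx    : ∀ x → x ∈ P → InVtx x
    distinct : Unique P
    adjacent : Linked (AdjGe n) P
    ends     : ∃[ mid ] (P ≡ u ∷ mid ++ v ∷ [])

module Submission where

-- Call the points of V_N barriers.  The arithmetic heart of the
-- lemma is that no edge of G_{≥N+1} jumps over a barrier: every edge of E_m
-- joins two points of one block [3k/3^m, (3k+3)/3^m], and for m > N every
-- barrier is a point c/3^N = 3w/3^m whose numerator is a multiple of 3, so it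
-- cannot lie strictly inside a block (no-crossing).
--
-- The rest is pure path combinatorics, developed in the module BarrierWalks
-- for an arbitrary step relation that never jumps upwards over a barrier:
-- a walk that starts below a barrier z and later reaches a value ≥ z must
-- visit z (climb, reach-end).  For a duplicate-free walk from the barrier u
-- to the barrier v this yields the three claims: every barrier of [u, v] is
-- visited, no vertex leaves [u, v] (otherwise u or v would be visited twice),
-- and barriers are visited in increasing order (otherwise a barrier would be
-- visited twice).

open import Defs
open import Data.Nat as ℕ using (ℕ; zero; suc; pred; _∸_; _^_; _+_; _*_; z≤n; s≤s)
import Data.Nat.Properties as NP
open import Data.Nat.Tactic.RingSolver using (solve-∀)
open import Data.Integer using (+_)
import Data.Integer.Properties as ℤP
open import Data.Rational using (ℚ; _≤_; _<_; toℚᵘ; fromℚᵘ)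
open import Data.Rational.Unnormalised as U using (ℚᵘ; mkℚᵘ; *<*)
import Data.Rational.Unnormalised.Properties as UP
import Data.Rational.Properties as QP
open import Data.Fin as Fin using (Fin; #_; toℕ)
open import Data.Fin.Properties using (toℕ≤pred[n])
open import Data.Product using (∃-syntax; _×_; _,_)
open import Data.Sum using (_⊎_; inj₁; inj₂)
open import Data.Empty using (⊥; ⊥-elim)
open import Data.List using (List; []; _∷_; _++_; [_]; length; lookup)
open import Data.List.Relation.Unary.Linked as Linked using (Linked; []; [-]; _∷_)
open import Data.List.Relation.Unary.Any using (Any; here; there)
open import Data.List.Relation.Unary.Any.Properties using (++⁺ʳ)
open import Data.List.Relation.Unary.AllPairs using (_∷_)
open import Data.List.Relation.Unary.Unique.Propositional using (Unique)
open import Data.List.Relation.Unary.Unique.Propositional.Properties using (Unique[x∷xs]⇒x∉xs)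
open import Data.List.Membership.Propositional using (_∈_; _∉_; lose)
open import Data.List.Membership.Propositional.Properties using (∈-lookup; ∈-++⁻; ∈-++⁺ʳ)
open import Relation.Binary using (tri<; tri≈; tri>)
open import Relation.Binary.PropositionalEquality using (_≡_; refl; sym; trans; cong; subst)

suc[pred[3^m]] : ∀ m → suc (pred (3 ^ m)) ≡ 3 ^ m
suc[pred[3^m]] m = NP.suc-pred (3 ^ m) {{NP.m^n≢0 3 m}}

-- the grid point k/3^m as an unnormalised rational (its denominator is stored minus one)
fracᵘ : ℕ → ℕ → ℚᵘ
fracᵘ k m = mkℚᵘ (+ k) (pred (3 ^ m))

toℚᵘ-frac : ∀ k m → toℚᵘ (frac k m) U.≃ fracᵘ k m
toℚᵘ-frac k m = subst (λ q → toℚᵘ q U.≃ fracᵘ k m) (sym frac≡) (QP.toℚᵘ-fromℚᵘ (fracᵘ k m))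
  where
  frac≡ : frac k m ≡ fromℚᵘ (fracᵘ k m)
  frac≡ = QP./-cong {+ k} {3 ^ m} {+ k} {suc (pred (3 ^ m))} {{NP.m^n≢0 3 m}}
            refl (sym (suc[pred[3^m]] m))

-- a strict inequality of grid points is a strict inequality of cross products;
-- ℚᵘ compares a/(1+pred 3^m) and c/(1+pred 3^N) by integer cross products, which
-- the rewrites turn into natural-number products
frac-<⇒ : ∀ {a m c N} → frac a m < frac c N → a * 3 ^ N ℕ.< c * 3 ^ m
frac-<⇒ {a} {m} {c} {N} lt
  with UP.<-respʳ-≃ (toℚᵘ-frac c N) (UP.<-respˡ-≃ (toℚᵘ-frac a m) (QP.toℚᵘ-mono-< lt))
... | *<* cross rewrite suc[pred[3^m]] m | suc[pred[3^m]] N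
                      | sym (ℤP.pos-* a (3 ^ N)) | sym (ℤP.pos-* c (3 ^ m)) = ℤP.drop‿+<+ cross

-- at the finer level N+1+d the point c/3^N has the numerator 3·c·3^d
rescale : ∀ c N d → c * 3 ^ (suc N + d) ≡ 3 * (c * 3 ^ d) * 3 ^ N
rescale c N d =
  trans (cong (λ t → c * (3 * t)) (NP.^-distribˡ-+-* 3 N d)) (solve-rescale c (3 ^ N) (3 ^ d))
  where
  solve-rescale : ∀ c x y → c * (3 * (x * y)) ≡ 3 * (c * y) * x
  solve-rescale = solve-∀

below-level : ∀ {p c N d} → frac p (suc N + d) < frac c N → p ℕ.< 3 * (c * 3 ^ d)
below-level {p} {c} {N} {d} lt =
  NP.*-cancelʳ-< (3 ^ N) p _
    (subst (p * 3 ^ N ℕ.<_) (rescale c N d) (frac-<⇒ {p} {suc N + d} {c} {N} lt))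

above-level : ∀ {q c N d} → frac c N < frac q (suc N + d) → 3 * (c * 3 ^ d) ℕ.< q
above-level {q} {c} {N} {d} lt =
  NP.*-cancelʳ-< (3 ^ N) _ q
    (subst (ℕ._< q * 3 ^ N) (rescale c N d) (frac-<⇒ {c} {N} {q} {suc N + d} lt))

no-multiple-of-3-in-block : ∀ k p q w → 3 * k ℕ.≤ p → q ℕ.≤ 3 * k + 3 →
  p ℕ.< 3 * w → 3 * w ℕ.< q → ⊥
no-multiple-of-3-in-block k p q w 3k≤p q≤3k+3 p<3w 3w<q = NP.<⇒≱ k<w (NP.≤-pred w<1+k)
  where
  3[1+k] : 3 * k + 3 ≡ 3 * suc k
  3[1+k] = trans (NP.+-comm (3 * k) 3) (sym (NP.*-suc 3 k))
  k<w : k ℕ.< w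
  k<w = NP.*-cancelˡ-< 3 k w (NP.≤-<-trans 3k≤p p<3w)
  w<1+k : w ℕ.< suc k
  w<1+k = NP.*-cancelˡ-< 3 w (suc k) (subst (3 * w ℕ.<_) 3[1+k] (NP.<-≤-trans 3w<q q≤3k+3))

InBlock : ℕ → ℕ → ℚ → Set
InBlock m k x = ∃[ i ] (x ≡ frac (3 * k + toℕ {4} i) m)

same-edge-in : ∀ (B : ℚ → Set) {a b x y} → B a → B b → SameEdge a b x y → B x × B y
same-edge-in B a∈B b∈B (inj₁ (refl , refl)) = a∈B , b∈B
same-edge-in B a∈B b∈B (inj₂ (refl , refl)) = b∈B , a∈B

-- the left end 3k/3^m of the k-th block (offset 0; the edge data write 3k rather than 3k + 0)
block-start : ∀ {m k} → InBlock m k (frac (3 * k) m)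
block-start {m} {k} = # 0 , cong (λ a → frac a m) (sym (NP.+-identityʳ (3 * k)))

edge-in-block : ∀ {m x y} → EdgeAt m x y → ∃[ k ] (InBlock m k x × InBlock m k y)
edge-in-block {m} (_ , k , _ , inj₁ e) =
  k , same-edge-in (InBlock m k) (block-start {m} {k}) (# 2 , refl) e
edge-in-block {m} (_ , k , _ , inj₂ (inj₁ e)) =
  k , same-edge-in (InBlock m k) (# 1 , refl) (# 2 , refl) e
edge-in-block {m} (_ , k , _ , inj₂ (inj₂ e)) =
  k , same-edge-in (InBlock m k) (# 1 , refl) (# 3 , refl) e

inside-block : ∀ {N d k x y c} → InBlock (suc N + d) k x → InBlock (suc N + d) k y →
  x < frac c N → frac c N < y → ⊥
inside-block {N} {d} {k} {c = c} (i , refl) (j , refl) x<z z<y =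
  no-multiple-of-3-in-block k _ _ (c * 3 ^ d)
    (NP.m≤m+n (3 * k) (toℕ i)) (NP.+-monoʳ-≤ (3 * k) (toℕ≤pred[n] j))
    (below-level {3 * k + toℕ i} {c} {N} {d} x<z)
    (above-level {3 * k + toℕ j} {c} {N} {d} z<y)

no-crossing : ∀ {N x y z} → AdjGe (suc N) x y → InV N z → x < z → z < y → ⊥
no-crossing {N} {x} {y} (m , N<m , edge) (c , _ , z≡c) x<z z<y =
  at-finer-level (NP.m≤n⇒∃[o]m+o≡n N<m)
  where
  -- the edge lies in a block of level m = N+1+d, which no point of level N enters
  at-finer-level : ∃[ d ] (suc N + d ≡ m) → ⊥
  at-finer-level (d , refl) with k , x∈B , y∈B ← edge-in-block edge =
    inside-block {N} {d} {k} {c = c} x∈B y∈B (subst (x <_) z≡c x<z) (subst (_< y) z≡c z<y)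

<⇒≱ : ∀ {p q : ℚ} → p < q → q ≤ p → ⊥
<⇒≱ p<q q≤p = QP.<-irrefl refl (QP.<-≤-trans p<q q≤p)

linked-prefix : ∀ {A : Set} {R : A → A → Set} xs {ys} → Linked R (xs ++ ys) → Linked R xs
linked-prefix [] _ = []
linked-prefix (x ∷ []) _ = [-]
linked-prefix (x ∷ y ∷ xs) (r ∷ rs) = r ∷ linked-prefix (y ∷ xs) rs

last-fresh : ∀ {A : Set} xs (e : A) → Unique (xs ++ [ e ]) → e ∉ xs
last-fresh (x ∷ xs) e unique (here refl) = Unique[x∷xs]⇒x∉xs unique (∈-++⁺ʳ xs (here refl))
last-fresh (x ∷ xs) e (_ ∷ unique) (there e∈xs) = last-fresh xs e unique e∈xs

module BarrierWalks
  (Barrier : ℚ → Set) (Step : ℚ → ℚ → Set)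
  (no-jump : ∀ {x y z} → Step x y → Barrier z → x < z → z < y → ⊥)
  where

  climb : ∀ {x z} ys → Barrier z → Linked Step (x ∷ ys) → x < z → Any (z ≤_) ys → z ∈ ys
  climb {z = z} (y ∷ ys) bz (step ∷ walk) x<z reaches with QP.<-cmp y z
  ... | tri≈ _ refl _ = here refl
  ... | tri> _ _ z<y = ⊥-elim (no-jump step bz x<z z<y)
  ... | tri< y<z _ _ with reaches
  ...   | here z≤y = ⊥-elim (<⇒≱ y<z z≤y)
  ...   | there reaches′ = there (climb ys bz walk y<z reaches′)

  reach-end : ∀ {x z} xs e → Barrier z → Linked Step (xs ++ [ e ]) →
    x ∈ xs ++ [ e ] → x < z → z ≤ e → z ∈ xs ++ [ e ]
  reach-end [] e bz walk (here refl) x<z z≤e = ⊥-elim (<⇒≱ x<z z≤e)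
  reach-end (x ∷ xs) e bz walk (here refl) x<z z≤e =
    there (climb (xs ++ [ e ]) bz walk x<z (++⁺ʳ xs (here z≤e)))
  reach-end (x ∷ xs) e bz walk (there x∈) x<z z≤e =
    there (reach-end xs e bz (Linked.tail walk) x∈ x<z z≤e)

  barrier-order : ∀ xs e → Linked Step (xs ++ [ e ]) → Unique (xs ++ [ e ]) →
    ∀ (i j : Fin (length (xs ++ [ e ]))) → let w = xs ++ [ e ] in
    Barrier (lookup w j) → lookup w j ≤ e → lookup w i < lookup w j → i Fin.< j
  barrier-order [] e _ _ Fin.zero Fin.zero _ _ lt = ⊥-elim (QP.<-irrefl refl lt)
  barrier-order (x ∷ xs) e _ _ Fin.zero Fin.zero _ _ lt = ⊥-elim (QP.<-irrefl refl lt)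
  barrier-order (x ∷ xs) e _ _ Fin.zero (Fin.suc j) _ _ _ = s≤s z≤n
  barrier-order (x ∷ xs) e walk unique (Fin.suc i) Fin.zero bx x≤e lt =
    ⊥-elim (Unique[x∷xs]⇒x∉xs unique
      (reach-end xs e bx (Linked.tail walk) (∈-lookup i) lt x≤e))
  barrier-order (x ∷ xs) e walk (_ ∷ unique) (Fin.suc i) (Fin.suc j) bj j≤e lt =
    s≤s (barrier-order xs e (Linked.tail walk) unique i j bj j≤e lt)

  module Between {u v : ℚ} (mid : List ℚ) (bu : Barrier u) (bv : Barrier v) (u<v : u < v)
           (walk : Linked Step (u ∷ mid ++ [ v ])) (unique : Unique (u ∷ mid ++ [ v ]))
    where

    visits-barriers : ∀ {z} → Barrier z → u ≤ z → z ≤ v → z ∈ u ∷ mid ++ [ v ]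
    visits-barriers {z} bz u≤z z≤v with QP.<-cmp u z
    ... | tri< u<z _ _ = reach-end (u ∷ mid) v bz walk (here refl) u<z z≤v
    ... | tri≈ _ refl _ = here refl
    ... | tri> _ _ z<u = ⊥-elim (<⇒≱ z<u u≤z)

    -- no vertex lies below the start: otherwise the walk would return to u
    above-start : ∀ {x} → x ∈ u ∷ mid ++ [ v ] → u ≤ x
    above-start (here refl) = QP.≤-refl
    above-start (there x∈) = QP.≮⇒≥ λ x<u →
      Unique[x∷xs]⇒x∉xs unique (reach-end mid v bu (Linked.tail walk) x∈ x<u (QP.<⇒≤ u<v))

    -- no vertex lies above the end: otherwise the walk would visit v before its end
    below-end : ∀ {x} → x ∈ u ∷ mid ++ [ v ] → x ≤ v
    below-end {x} x∈ = QP.≮⇒≥ λ v<x → refute v<x (∈-++⁻ (u ∷ mid) x∈)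
      where
      refute : v < x → x ∈ u ∷ mid ⊎ x ∈ [ v ] → ⊥
      refute v<x (inj₂ (here refl)) = QP.<-irrefl refl v<x
      refute v<x (inj₁ (here refl)) = QP.<-asym u<v v<x
      refute v<x (inj₁ (there x∈mid)) =
        last-fresh (u ∷ mid) v unique
          (there (climb mid bv (linked-prefix (u ∷ mid) walk) u<v (lose x∈mid (QP.<⇒≤ v<x))))

lemma2p2 : (u v : ℚ) (n : ℕ) → InVtx u → InVtx v → u < v → 1 ℕ.< n →
    InV (n ∸ 1) u → InV (n ∸ 1) v →
    (P : List ℚ) → IsPathGe n u v P →
    (∀ x → InV (n ∸ 1) x → u ≤ x → x ≤ v → x ∈ P)
    × (∀ x → x ∈ P → InVtx x × u ≤ x × x ≤ v)
    × (∀ (i j : Fin (length P)) →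
         InV (n ∸ 1) (lookup P i) → InV (n ∸ 1) (lookup P j) →
         u ≤ lookup P i → lookup P i ≤ v →
         u ≤ lookup P j → lookup P j ≤ v →
         lookup P i < lookup P j → i Fin.< j)
lemma2p2 u v zero _ _ _ () _ _ _ _
lemma2p2 u v (suc N) _ _ u<v _ u∈V v∈V P path with mid , refl ← IsPathGe.ends path =
    (λ x x∈V u≤x x≤v → visits-barriers x∈V u≤x x≤v)
  , (λ x x∈P → inVtx x x∈P , above-start x∈P , below-end x∈P)
  , (λ i j _ j∈V _ _ _ j≤v lt → barrier-order (u ∷ mid) v adjacent distinct i j j∈V j≤v lt)
  where
  open IsPathGe path
  open BarrierWalks (InV N) (AdjGe (suc N)) no-crossing
  open Between mid u∈V v∈V u<v adjacent distinct
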